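{- Let $m,n$ be positive integers with $m>n$ and $m\ge 3$, and let $q$ be an odd prime. Let $(X,y_1,y_2)$ be positive integers with $X>1$, $\gcd(X,q)=1$, $y_1>y_2$ and $X^m-X^n=q^{y_1}-q^{y_2}$. Put $E=e_q(X)$, $N=(m-n)/E$, $e=\nu_q(N)$, and assume $N$ is odd. Let $A_E(t)=t-1$ if $E=1$ and $A_E(t)=t^{E-1}+\cdots+t+1$ if $E>1$; $B_{n,E}(t)=t^n$ if $E=1$ and $B_{n,E}(t)=t^n(t-1)$ if $E>1$; $I_{E,N}(t)=t^{E(N-1)}+t^{E(N-2)}+\cdots+t^E+1$. Then $y_2>e$, $I_{E,N}(X)\equiv 0\pmod{q^e}$, and there is a positive integer $K$ with $\gcd(K,q)=1$ such that \[A_E(X)=Kq^{y_2-e},\qquad B_{n,E}(X)\,I_{E,N}(X)\,K=q^e(q^{y_1-y_2}-1).\] Moreover: (i) If $E=1$, then $y_1>2(y_2-e)$; and if furthermore $K>1$, then $y_1>m(y_2-e)$. (ii) If $E>1$, then $y_1\ge \frac{m}{E-1}(y_2-e)$ if $K>1$, and $y_1\ge 2(y_2-e)$ if $\dfrac{(y_2-e)(m-2E+2)+E-1}{m+\delta(E-1)}\ge \dfrac{\log 2}{\log q}$, where $\delta=1$ if $X^m>q^{y_1}$ and $\delta=0$ if $X^m<q^{y_1}$.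
   Context: For a positive integer $M$ and an integer $A$ coprime to $M$, $e_M(A)$ is the least positive integer $e$ such that $A^e\equiv \pm1\pmod M$ (it divides $m-n$ here). For a prime $q$, $\nu_q(A)$ is the exponent of $q$ in the nonzero integer $A$. -}

module Defs where

open import Data.Nat using (ℕ; zero; suc; _+_; _*_; _∸_; _^_; _≤_; _<_)
open import Data.Nat.Divisibility using (_∣_)
open import Data.Integer as ℤ using (ℤ; +_)
import Data.Integer.Divisibility as ℤD
open import Data.Sum using (_⊎_)
open import Data.Product using (_×_; Σ)
open import Relation.Nullary using (¬_)
open import Relation.Binary.PropositionalEquality using (_≡_)

PlusMinusOne : ℕ → ℕ → ℕ → Set
PlusMinusOne M A e =
  ((+ M) ℤD.∣ (+ (A ^ e) ℤ.- ℤ.1ℤ)) ⊎ ((+ M) ℤD.∣ (+ (A ^ e) ℤ.+ ℤ.1ℤ))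

IsE : ℕ → ℕ → ℕ → Set
IsE M A E = (0 < E) × PlusMinusOne M A E × (∀ e → 0 < e → PlusMinusOne M A e → E ≤ e)

IsVal : ℕ → ℕ → ℕ → Set
IsVal q N v = (q ^ v ∣ N) × ¬ (q ^ suc v ∣ N)

geomSum : ℕ → ℕ → ℕ → ℕ
geomSum s t zero    = 0
geomSum s t (suc k) = geomSum s t k + t ^ (s * k)

A-poly : ℕ → ℕ → ℕ
A-poly 1 t = t ∸ 1
A-poly E t = geomSum 1 t E

B-poly : ℕ → ℕ → ℕ → ℕ
B-poly n 1 t = t ^ n
B-poly n E t = t ^ n * (t ∸ 1)

I-poly : ℕ → ℕ → ℕ → ℕ
I-poly E N t = geomSum E t N

-- The condition  ((y2-e)(m-2E+2)+E-1) / (m + δ(E-1)) ≥ log 2 / log q,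
-- with numerator a ∈ ℤ and denominator b > 0, i.e. a·log q ≥ b·log 2,
-- i.e. a ≥ 0 and q^a ≥ 2^b.
LogCond : ℕ → ℕ → ℕ → ℕ → ℕ → ℕ → Set
LogCond q m E y2 e δ =
  Σ ℕ λ a →
    ((+ (y2 ∸ e)) ℤ.* ((+ m) ℤ.- (+ (2 * E)) ℤ.+ (+ 2)) ℤ.+ (+ E) ℤ.- ℤ.1ℤ ≡ + a)
    × (2 ^ (m + δ * (E ∸ 1)) ≤ q ^ a)

-- Factor X^m − X^n = X^n (X^E − 1) I_{E,N}(X) and q^y₁ − q^y₂ = q^y₂ (q^(y₁−y₂) − 1). As q ∤ X,
-- the q-adic valuation of (X^E − 1) I_{E,N}(X) is y₂. Since N is odd, X^E ≡ −1 (mod q) would give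
-- X^(EN) ≡ −1, so in fact X^E ≡ 1 (mod q), and lifting the exponent gives ν_q(I_{E,N}(X)) = ν_q(N) = e.
-- Hence ν_q(X^E − 1) = y₂ − e > 0. For E > 1 minimality of E gives q ∤ X − 1, so the whole valuation
-- sits in A_E(X) = (X^E − 1)/(X − 1), and K is its q-free part. The inequalities compare the lower
-- bound A_E(X) ≥ K q^(y₂−e) with the upper bound X^(m−E) (X^E − 1) ≤ X^m − X^n < q^y₁.

module Submission where

open import Defs
open import Data.Nat
  using ( ℕ; zero; suc; _+_; _*_; _∸_; _^_; _≤_; _<_; _>_; _≥_; z≤n; s≤s; s≤s⁻¹; z<s
        ; NonZero; >-nonZero; >-nonZero⁻¹; nonTrivial⇒n>1)
open import Data.Nat.Properties
open import Data.Nat.Divisibility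
open import Data.Nat.Coprimality using (Coprime)
open import Data.Nat.Primality using (Prime; euclidsLemma; prime⇒irreducible; prime⇒nonTrivial; prime⇒nonZero; prime[2])
open import Data.Nat.Tactic.RingSolver using (solve-∀)
import Data.Integer as ℤ
import Data.Integer.Divisibility as ℤ
import Data.Integer.Properties as ℤ
import Data.Integer.Tactic.RingSolver as ℤ-Solver
open import Data.Product using (_×_; _,_; proj₁; proj₂; Σ; ∃-syntax; map₁)
open import Data.Sum using (_⊎_; inj₁; inj₂)
open import Relation.Nullary using (¬_; contradiction)
open import Relation.Binary.PropositionalEquality

^-cancelˡ-< : ∀ q {a b} → 1 < q → q ^ a < q ^ b → a < b
^-cancelˡ-< q@(suc _) 1<q qᵃ<qᵇ = ≰⇒> (λ b≤a → <⇒≱ qᵃ<qᵇ (^-monoʳ-≤ q b≤a))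

^-distrib-* : ∀ a b n → (a * b) ^ n ≡ a ^ n * b ^ n
^-distrib-* a b zero    = refl
^-distrib-* a b (suc n) = trans (cong (a * b *_) (^-distrib-* a b n)) (interchange a b (a ^ n) (b ^ n))
  where
  interchange : ∀ a b c d → a * b * (c * d) ≡ a * c * (b * d)
  interchange = solve-∀

suc≤2* : ∀ {x} → 0 < x → suc x ≤ 2 * x
suc≤2* {x} 0<x = m<m+n x (subst (0 <_) (sym (+-identityʳ x)) 0<x)

^-∸-factor : ∀ X {m n} → n ≤ m → X ^ m ∸ X ^ n ≡ X ^ n * (X ^ (m ∸ n) ∸ 1)
^-∸-factor X {m} {n} n≤m = begin
  X ^ m ∸ X ^ n                     ≡⟨ cong₂ _∸_ (cong (X ^_) (sym (m+[n∸m]≡n n≤m))) (sym (*-identityʳ (X ^ n))) ⟩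
  X ^ (n + (m ∸ n)) ∸ X ^ n * 1     ≡⟨ cong (_∸ X ^ n * 1) (^-distribˡ-+-* X n (m ∸ n)) ⟩
  X ^ n * X ^ (m ∸ n) ∸ X ^ n * 1   ≡⟨ sym (*-distribˡ-∸ (X ^ n) (X ^ (m ∸ n)) 1) ⟩
  X ^ n * (X ^ (m ∸ n) ∸ 1)         ∎
  where open ≡-Reasoning

m∣m^n : ∀ m {n} → 0 < n → m ∣ m ^ n
m∣m^n m {suc n} _ = m∣m*n (m ^ n)

odd⇒suc[*2] : ∀ {n} → ¬ 2 ∣ n → ∃[ h ] n ≡ suc (h * 2)
odd⇒suc[*2] {zero}        2∤0 = contradiction (2 ∣0) 2∤0
odd⇒suc[*2] {suc zero}    _   = 0 , refl
odd⇒suc[*2] {suc (suc n)} 2∤n+2 with odd⇒suc[*2] {n} (λ 2∣n → 2∤n+2 (∣m∣n⇒∣m+n (∣-refl {2}) 2∣n))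
... | h , refl = suc h , refl

-- Geometric sums

geom : ℕ → ℕ → ℕ
geom = geomSum 1

geom-suc : ∀ t k → geom t (suc k) ≡ geom t k + t ^ k
geom-suc t k = cong (λ i → geom t k + t ^ i) (*-identityˡ k)

geomSum≡geom : ∀ s t k → geomSum s t k ≡ geom (t ^ s) k
geomSum≡geom s t zero    = refl
geomSum≡geom s t (suc k) =
  trans (cong₂ _+_ (geomSum≡geom s t k) (sym (^-*-assoc t s k))) (sym (geom-suc (t ^ s) k))

^≤geom : ∀ t k → t ^ k ≤ geom t (suc k)
^≤geom t k = subst (t ^ k ≤_) (sym (geom-suc t k)) (m≤n+m (t ^ k) (geom t k))

geom-telescope : ∀ x k → x * geom (suc x) k + 1 ≡ suc x ^ k
geom-telescope x zero    = cong (_+ 1) (*-zeroʳ x)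
geom-telescope x (suc k) = begin
  x * geom (suc x) (suc k) + 1             ≡⟨ cong (λ g → x * g + 1) (geom-suc (suc x) k) ⟩
  x * (geom (suc x) k + suc x ^ k) + 1     ≡⟨ expand x (geom (suc x) k) (suc x ^ k) ⟩
  (x * geom (suc x) k + 1) + x * suc x ^ k ≡⟨ cong (_+ x * suc x ^ k) (geom-telescope x k) ⟩
  suc x ^ k + x * suc x ^ k                ∎
  where
  open ≡-Reasoning
  expand : ∀ x g p → x * (g + p) + 1 ≡ (x * g + 1) + x * p
  expand = solve-∀

pred*geom : ∀ t k → (t ∸ 1) * geom t k ≡ t ^ k ∸ 1
pred*geom zero    zero    = refl
pred*geom zero    (suc k) = refl
pred*geom (suc x) k       = trans (sym (m+n∸n≡m (x * geom (suc x) k) 1)) (cong (_∸ 1) (geom-telescope x k))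

geom-+ : ∀ t a b → geom t (a + b) ≡ geom t a + t ^ a * geom t b
geom-+ t a zero    = begin
  geom t (a + 0)         ≡⟨ cong (geom t) (+-identityʳ a) ⟩
  geom t a               ≡⟨ sym (+-identityʳ (geom t a)) ⟩
  geom t a + 0           ≡⟨ cong (geom t a +_) (sym (*-zeroʳ (t ^ a))) ⟩
  geom t a + t ^ a * 0   ∎
  where open ≡-Reasoning
geom-+ t a (suc b) = begin
  geom t (a + suc b)                          ≡⟨ cong (geom t) (+-suc a b) ⟩
  geom t (suc (a + b))                        ≡⟨ geom-suc t (a + b) ⟩
  geom t (a + b) + t ^ (a + b)                ≡⟨ cong₂ _+_ (geom-+ t a b) (^-distribˡ-+-* t a b) ⟩
  geom t a + t ^ a * geom t b + t ^ a * t ^ b ≡⟨ factor (geom t a) (t ^ a) (geom t b) (t ^ b) ⟩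
  geom t a + t ^ a * (geom t b + t ^ b)       ≡⟨ cong (λ g → geom t a + t ^ a * g) (sym (geom-suc t b)) ⟩
  geom t a + t ^ a * geom t (suc b)           ∎
  where
  open ≡-Reasoning
  factor : ∀ g p h r → g + p * h + p * r ≡ g + p * (h + r)
  factor = solve-∀

geom-* : ∀ t k M → geom t (k * M) ≡ geom (t ^ M) k * geom t M
geom-* t zero    M = refl
geom-* t (suc k) M = begin
  geom t (M + k * M)                                 ≡⟨ geom-+ t M (k * M) ⟩
  geom t M + t ^ M * geom t (k * M)                  ≡⟨ cong (λ g → geom t M + t ^ M * g) (geom-* t k M) ⟩
  geom t M + t ^ M * (geom (t ^ M) k * geom t M)     ≡⟨ factor (geom t M) (t ^ M) (geom (t ^ M) k) ⟩
  (1 + t ^ M * geom (t ^ M) k) * geom t M            ≡⟨ cong (_* geom t M) (sym (geom-sucˡ (t ^ M) k)) ⟩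
  geom (t ^ M) (suc k) * geom t M                    ∎
  where
  open ≡-Reasoning
  factor : ∀ g p h → g + p * (h * g) ≡ (1 + p * h) * g
  factor = solve-∀
  geom-sucˡ : ∀ z k → geom z (suc k) ≡ 1 + z * geom z k
  geom-sucˡ z k = trans (geom-+ z 1 k) (cong (λ w → 1 + w * geom z k) (*-identityʳ z))

suc∣^odd+1 : ∀ t j → suc t ∣ t ^ suc (j * 2) + 1
suc∣^odd+1 zero    j       = 1∣ _
suc∣^odd+1 (suc y) zero    = divides 1 (twice y)
  where
  twice : ∀ y → suc y * 1 + 1 ≡ 1 * suc (suc y)
  twice = solve-∀
suc∣^odd+1 (suc y) (suc j) =
  ∣m+n∣m⇒∣n (subst (suc (suc y) ∣_) (expand y (suc y ^ suc (j * 2))) (∣n⇒∣m*n (suc y * suc y) (suc∣^odd+1 (suc y) j)))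
            (m∣m*n y)
  where
  expand : ∀ y Z → suc y * suc y * (Z + 1) ≡ suc (suc y) * y + (suc y * (suc y * Z) + 1)
  expand = solve-∀

pow-expansion : ∀ u i → ∃[ r ] (1 + u) ^ i ≡ 1 + i * u + u * u * r
pow-expansion u zero    = 0 , cong suc (sym (*-zeroʳ (u * u)))
pow-expansion u (suc i) with pow-expansion u i
... | r , eq = i + r + u * r , trans (cong ((1 + u) *_) eq) (expand u i r)
  where
  expand : ∀ u i r → (1 + u) * (1 + i * u + u * u * r) ≡ 1 + (1 + i) * u + u * u * (i + r + u * r)
  expand = solve-∀

triangle : ℕ → ℕ
triangle zero    = 0
triangle (suc k) = triangle k + k

triangle-odd : ∀ h → triangle (suc (h * 2)) ≡ suc (h * 2) * h
triangle-odd zero    = refl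
triangle-odd (suc h) = trans (cong (λ T → T + suc (h * 2) + suc (suc (h * 2))) (triangle-odd h)) (expand h)
  where
  expand : ∀ h → suc (h * 2) * h + suc (h * 2) + suc (suc (h * 2)) ≡ suc (suc h * 2) * suc h
  expand = solve-∀

geom-expansion : ∀ u k → ∃[ R ] geom (1 + u) k ≡ k + u * triangle k + u * u * R
geom-expansion u zero    = 0 , zeros u
  where
  zeros : ∀ u → 0 ≡ 0 + u * 0 + u * u * 0
  zeros = solve-∀
geom-expansion u (suc k) with geom-expansion u k | pow-expansion u k
... | R , geom≡ | r , pow≡ =
  R + r , trans (geom-suc (1 + u) k) (trans (cong₂ _+_ geom≡ pow≡) (collect k u (triangle k) R r))
  where
  collect : ∀ k u T R r → k + u * T + u * u * R + (1 + k * u + u * u * r) ≡ suc k + u * (T + k) + u * u * (R + r)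
  collect = solve-∀

pow-≡1-mod : ∀ q t i → ∃[ c ] (1 + q * t) ^ i ≡ 1 + q * c
pow-≡1-mod q t i with pow-expansion (q * t) i
... | r , eq = i * t + t * (q * t) * r , trans eq (regroup q t i r)
  where
  regroup : ∀ q t i r → 1 + i * (q * t) + q * t * (q * t) * r ≡ 1 + q * (i * t + t * (q * t) * r)
  regroup = solve-∀

geom-≡length-mod : ∀ q t k → ∃[ c ] geom (1 + q * t) k ≡ k + q * c
geom-≡length-mod q t k with geom-expansion (q * t) k
... | R , eq = t * triangle k + t * (q * t) * R , trans eq (regroup q t k (triangle k) R)
  where
  regroup : ∀ q t k T R → k + q * t * T + q * t * (q * t) * R ≡ k + q * (t * T + t * (q * t) * R)
  regroup = solve-∀

-- For odd q the linear term q·t·(q choose 2) is divisible by q².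
geom-≡q-mod-q² : ∀ h t → let q = suc (h * 2) in ∃[ c ] geom (1 + q * t) q ≡ q * (1 + q * c)
geom-≡q-mod-q² h t with geom-expansion (suc (h * 2) * t) (suc (h * 2))
... | R , eq = t * h + t * t * R ,
  trans eq (trans (cong (λ T → q + q * t * T + q * t * (q * t) * R) (triangle-odd h)) (regroup q t h R))
  where
  q = suc (h * 2)
  regroup : ∀ q t h R → q + q * t * (q * h) + q * t * (q * t) * R ≡ q * (1 + q * (t * h + t * t * R))
  regroup = solve-∀

-- q-adic valuations

record Valuation (q a v : ℕ) : Set where
  constructor valuation
  field
    cofactor      : ℕ
    factorisation : a ≡ q ^ v * cofactor
    ∤cofactor     : ¬ q ∣ cofactor

IsVal⇒Valuation : ∀ {q a v} → IsVal q a v → Valuation q a v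
IsVal⇒Valuation {q} {a} {v} (divides b a≡bqᵛ , qᵛ⁺¹∤a) =
  valuation b (trans a≡bqᵛ (*-comm b (q ^ v))) (λ q∣b → qᵛ⁺¹∤a (qᵛ⁺¹∣a q∣b))
  where
  qᵛ⁺¹∣a : q ∣ b → q ^ suc v ∣ a
  qᵛ⁺¹∣a (divides c refl) = divides c (trans a≡bqᵛ (*-assoc c q (q ^ v)))

Valuation⇒∣ : ∀ {q a v} → Valuation q a v → q ^ v ∣ a
Valuation⇒∣ {q} {v = v} (valuation b refl _) = divides b (*-comm (q ^ v) b)

module _ {q : ℕ} (q-prime : Prime q) where

  private instance
    q≢0 : NonZero q
    q≢0 = prime⇒nonZero q-prime

  prime⇒1< : 1 < q
  prime⇒1< = nonTrivial⇒n>1 q {{prime⇒nonTrivial q-prime}}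

  ∤1 : ¬ q ∣ 1
  ∤1 q∣1 = <⇒≢ prime⇒1< (sym (∣1⇒≡1 q∣1))

  ∤* : ∀ {a b} → ¬ q ∣ a → ¬ q ∣ b → ¬ q ∣ a * b
  ∤* {a} {b} q∤a q∤b q∣ab with euclidsLemma a b q-prime q∣ab
  ... | inj₁ q∣a = q∤a q∣a
  ... | inj₂ q∣b = q∤b q∣b

  ∤^ : ∀ {a} k → ¬ q ∣ a → ¬ q ∣ a ^ k
  ∤^ zero    q∤a = ∤1
  ∤^ (suc k) q∤a = ∤* q∤a (∤^ k q∤a)

  coprime⇒∤ : ∀ {a} → Coprime a q → ¬ q ∣ a
  coprime⇒∤ a⊥q q∣a = <⇒≢ prime⇒1< (sym (a⊥q (q∣a , ∣-refl)))

  ∤⇒coprime : ∀ {a} → ¬ q ∣ a → Coprime a q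
  ∤⇒coprime q∤a (d∣a , d∣q) with prime⇒irreducible q-prime d∣q
  ... | inj₁ d≡1 = d≡1
  ... | inj₂ refl = contradiction d∣a q∤a

  ∤^∸1 : ∀ d → 0 < d → ¬ q ∣ q ^ d ∸ 1
  ∤^∸1 (suc d) _ q∣qᵈ⁺¹∸1 = ∤1 (∣m+n∣m⇒∣n q∣qᵈ⁺¹ q∣qᵈ⁺¹∸1)
    where
    q∣qᵈ⁺¹ : q ∣ (q ^ suc d ∸ 1) + 1
    q∣qᵈ⁺¹ = subst (q ∣_) (sym (m∸n+n≡m (m^n>0 q (suc d)))) (m∣m*n (q ^ d))

  Valuation-∣⇒>0 : ∀ {a v} → q ∣ a → Valuation q a v → 0 < v
  Valuation-∣⇒>0 {v = zero}  q∣a (valuation b refl q∤b) = contradiction (subst (q ∣_) (+-identityʳ b) q∣a) q∤b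
  Valuation-∣⇒>0 {v = suc v} _   _                       = z<s

  Valuation-* : ∀ {a b v w} → Valuation q a v → Valuation q b w → Valuation q (a * b) (v + w)
  Valuation-* {v = v} {w} (valuation a′ refl q∤a′) (valuation b′ refl q∤b′) =
    valuation (a′ * b′)
      (trans (interchange (q ^ v) a′ (q ^ w) b′) (cong (_* (a′ * b′)) (sym (^-distribˡ-+-* q v w))))
      (∤* q∤a′ q∤b′)
    where
    interchange : ∀ x a y b → x * a * (y * b) ≡ x * y * (a * b)
    interchange = solve-∀

  Valuation-q* : ∀ {a v} → Valuation q a v → Valuation q (q * a) (suc v)
  Valuation-q* {v = v} (valuation b refl q∤b) = valuation b (sym (*-assoc q (q ^ v) b)) q∤b

  Valuation-q*⁻¹ : ∀ {a v} → Valuation q (q * a) (suc v) → Valuation q a v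
  Valuation-q*⁻¹ {a} {v} (valuation b qa≡qqᵛb q∤b) =
    valuation b (*-cancelˡ-≡ a (q ^ v * b) q (trans qa≡qqᵛb (*-assoc q (q ^ v) b))) q∤b

  Valuation-*-∤ : ∀ {a c} v → ¬ q ∣ c → Valuation q (a * c) v → Valuation q a v
  Valuation-*-∤ {a} zero q∤c (valuation b ac≡b q∤b) =
    valuation a (sym (+-identityʳ a)) (λ q∣a → q∤b (subst (q ∣_) (trans ac≡b (+-identityʳ b)) (∣m⇒∣m*n _ q∣a)))
  Valuation-*-∤ {a} {c} (suc v) q∤c val with euclidsLemma a c q-prime (∣-trans (m∣m*n (q ^ v)) (Valuation⇒∣ val))
  ... | inj₂ q∣c = contradiction q∣c q∤c
  ... | inj₁ (divides a′ refl) =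
    subst (λ z → Valuation q z (suc v)) (*-comm q a′)
      (Valuation-q* (Valuation-*-∤ v q∤c (Valuation-q*⁻¹ (subst (λ z → Valuation q z (suc v)) (pull a′ q c) val))))
    where
    pull : ∀ a q c → a * q * c ≡ q * (a * c)
    pull = solve-∀

  Valuation-cancelʳ : ∀ {a b v} w → Valuation q (a * b) v → Valuation q b w → w ≤ v × Valuation q a (v ∸ w)
  Valuation-cancelʳ {a} {v = v} zero val (valuation b refl q∤b) =
    z≤n , Valuation-*-∤ v q∤b (subst (λ z → Valuation q (a * z) v) (+-identityʳ b) val)
  Valuation-cancelʳ {a} {v = zero} (suc w) val (valuation b refl _) =
    contradiction (Valuation-∣⇒>0 (∣n⇒∣m*n a (∣m⇒∣m*n b (m∣m*n (q ^ w)))) val) (λ ())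
  Valuation-cancelʳ {a} {v = suc v} (suc w) val (valuation b refl q∤b) =
    map₁ s≤s (Valuation-cancelʳ w (Valuation-q*⁻¹ (subst (λ z → Valuation q z (suc v)) (pull a q (q ^ w) b) val))
                                  (valuation b refl q∤b))
    where
    pull : ∀ a q x b → a * (q * x * b) ≡ q * (a * (x * b))
    pull = solve-∀

  Valuation-geom : ¬ 2 ∣ q → ∀ t {N} e → Valuation q N e → Valuation q (geom (1 + q * t) N) e
  Valuation-geom _ t zero (valuation N refl q∤N) =
    valuation (geom (1 + q * t) (1 * N)) (sym (+-identityʳ _)) q∤geom
    where
    q∤geom : ¬ q ∣ geom (1 + q * t) (1 * N)
    q∤geom q∣geom with geom-≡length-mod q t (1 * N)
    ... | c , geom≡ = q∤N (subst (q ∣_) (+-identityʳ N)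
                        (∣m+n∣m⇒∣n (subst (q ∣_) (trans geom≡ (+-comm (1 * N) (q * c))) q∣geom) (m∣m*n c)))
  Valuation-geom q∤2 t (suc e) (valuation N refl q∤N) with odd⇒suc[*2] q∤2 | pow-≡1-mod q t (q ^ e * N)
  ... | h , refl | t′ , Yᴹ≡ with geom-≡q-mod-q² h t′
  ...   | c , geomᵠ≡ =
    subst (λ G → Valuation q G (suc e)) (sym geom≡)
      (Valuation-* (valuation (1 + q * c) (trans geomᵠ≡ (cong (_* (1 + q * c)) (sym (*-identityʳ q)))) q∤1+qc)
                   (Valuation-geom q∤2 t e (valuation N refl q∤N)))
    where
    Y = 1 + q * t
    M = q ^ e * N
    geom≡ : geom Y (q * q ^ e * N) ≡ geom (1 + q * t′) q * geom Y M
    geom≡ = begin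
      geom Y (q * q ^ e * N)         ≡⟨ cong (geom Y) (*-assoc q (q ^ e) N) ⟩
      geom Y (q * M)                 ≡⟨ geom-* Y q M ⟩
      geom (Y ^ M) q * geom Y M      ≡⟨ cong (λ Z → geom Z q * geom Y M) Yᴹ≡ ⟩
      geom (1 + q * t′) q * geom Y M ∎
      where open ≡-Reasoning
    q∤1+qc : ¬ q ∣ 1 + q * c
    q∤1+qc q∣1+qc = ∤1 (∣m+n∣m⇒∣n (subst (q ∣_) (+-comm 1 (q * c)) q∣1+qc) (m∣m*n c))

  ∣^∸1⇒∤+1 : ¬ 2 ∣ q → ∀ {N} → ¬ 2 ∣ N → ∀ Y → q ∣ Y ^ N ∸ 1 → ¬ q ∣ Y + 1
  ∣^∸1⇒∤+1 _   _   zero    _       = ∤1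
  ∣^∸1⇒∤+1 q∤2 2∤N (suc y) q∣Yᴺ∸1 q∣Y+1 with odd⇒suc[*2] 2∤N
  ... | j , refl with prime⇒irreducible prime[2] (∣m+n∣m⇒∣n q∣Yᴺ∸1+2 q∣Yᴺ∸1)
    where
    Yᴺ = suc y ^ suc (j * 2)
    q∣Yᴺ∸1+2 : q ∣ (Yᴺ ∸ 1) + 2
    q∣Yᴺ∸1+2 = subst (q ∣_) (trans (cong (_+ 1) (sym (m∸n+n≡m (m^n>0 (suc y) (suc (j * 2)))))) (+-assoc (Yᴺ ∸ 1) 1 1))
                 (∣-trans (subst (q ∣_) (+-comm (suc y) 1) q∣Y+1) (suc∣^odd+1 (suc y) j))
  ... | inj₁ q≡1 = <⇒≢ prime⇒1< (sym q≡1)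
  ... | inj₂ refl = q∤2 ∣-refl

-- The factorisation of X^m − X^n and its valuations

^∸1≡[^∸1]*I-poly : ∀ X E N → X ^ (E * N) ∸ 1 ≡ (X ^ E ∸ 1) * I-poly E N X
^∸1≡[^∸1]*I-poly X E N = begin
  X ^ (E * N) ∸ 1                   ≡⟨ cong (_∸ 1) (sym (^-*-assoc X E N)) ⟩
  (X ^ E) ^ N ∸ 1                   ≡⟨ sym (pred*geom (X ^ E) N) ⟩
  (X ^ E ∸ 1) * geom (X ^ E) N      ≡⟨ cong ((X ^ E ∸ 1) *_) (sym (geomSum≡geom E X N)) ⟩
  (X ^ E ∸ 1) * I-poly E N X        ∎
  where open ≡-Reasoning

key-identity : ∀ {m n q X y₁ y₂ E N} → n ≤ m → y₂ ≤ y₁ → m ∸ n ≡ E * N →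
               X ^ m ∸ X ^ n ≡ q ^ y₁ ∸ q ^ y₂ →
               X ^ n * ((X ^ E ∸ 1) * I-poly E N X) ≡ q ^ y₂ * (q ^ (y₁ ∸ y₂) ∸ 1)
key-identity {m} {n} {q} {X} {y₁} {y₂} {E} {N} n≤m y₂≤y₁ m∸n≡EN Xᵐ∸Xⁿ≡ = begin
  X ^ n * ((X ^ E ∸ 1) * I-poly E N X) ≡⟨ cong (X ^ n *_) (sym (^∸1≡[^∸1]*I-poly X E N)) ⟩
  X ^ n * (X ^ (E * N) ∸ 1)            ≡⟨ cong (λ k → X ^ n * (X ^ k ∸ 1)) (sym m∸n≡EN) ⟩
  X ^ n * (X ^ (m ∸ n) ∸ 1)            ≡⟨ sym (^-∸-factor X n≤m) ⟩
  X ^ m ∸ X ^ n                        ≡⟨ Xᵐ∸Xⁿ≡ ⟩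
  q ^ y₁ ∸ q ^ y₂                      ≡⟨ ^-∸-factor q y₂≤y₁ ⟩
  q ^ y₂ * (q ^ (y₁ ∸ y₂) ∸ 1)         ∎
  where open ≡-Reasoning

size-bound : ∀ {X m n E Q₁ Q₂} → .{{NonZero X}} → n + E ≤ m → 0 < Q₂ → Q₂ ≤ Q₁ →
             X ^ m ∸ X ^ n ≡ Q₁ ∸ Q₂ →
             X ^ (m ∸ E) * (X ^ E ∸ 1) < Q₁
size-bound {X} {m} {n} {E} {Q₁} {Q₂} n+E≤m 0<Q₂ Q₂≤Q₁ Xᵐ∸Xⁿ≡ = begin-strict
  X ^ (m ∸ E) * (X ^ E ∸ 1)             ≡⟨ cong (λ k → X ^ (m ∸ E) * (X ^ k ∸ 1)) (sym (m∸[m∸n]≡n E≤m)) ⟩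
  X ^ (m ∸ E) * (X ^ (m ∸ (m ∸ E)) ∸ 1) ≡⟨ sym (^-∸-factor X (m∸n≤m m E)) ⟩
  X ^ m ∸ X ^ (m ∸ E)                   ≤⟨ ∸-monoʳ-≤ (X ^ m) (^-monoʳ-≤ X (m+n≤o⇒m≤o∸n n n+E≤m)) ⟩
  X ^ m ∸ X ^ n                         ≡⟨ Xᵐ∸Xⁿ≡ ⟩
  Q₁ ∸ Q₂                               <⟨ ∸-monoʳ-< 0<Q₂ Q₂≤Q₁ ⟩
  Q₁                                    ∎
  where
  open ≤-Reasoning
  E≤m : E ≤ m
  E≤m = ≤-trans (m≤n+m E n) n+E≤m

PlusMinusOne⇒∣ : ∀ {q} A e → PlusMinusOne q A e → q ∣ A ^ e ∸ 1 ⊎ q ∣ A ^ e + 1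
PlusMinusOne⇒∣ {q} A e = ℕ-form (A ^ e)
  where
  -- ℤ divisibility compares absolute values, and ∣ + suc z − 1 ∣ reduces to z.
  ℕ-form : ∀ Z → (ℤ.+ q) ℤ.∣ (ℤ.+ Z ℤ.- ℤ.1ℤ) ⊎ (ℤ.+ q) ℤ.∣ (ℤ.+ Z ℤ.+ ℤ.1ℤ) →
           q ∣ Z ∸ 1 ⊎ q ∣ Z + 1
  ℕ-form zero    _  = inj₁ (q ∣0)
  ℕ-form (suc z) ±1 = ±1

record CoreFacts (q X m n E N e y₁ y₂ : ℕ) : Set where
  field
    E≤m            : E ≤ m
    identity       : X ^ n * ((X ^ E ∸ 1) * I-poly E N X) ≡ q ^ y₂ * (q ^ (y₁ ∸ y₂) ∸ 1)
    bound          : X ^ (m ∸ E) * (X ^ E ∸ 1) < q ^ y₁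
    e<y₂           : e < y₂
    Valuation-I    : Valuation q (I-poly E N X) e
    Valuation-Xᴱ∸1 : Valuation q (X ^ E ∸ 1) (y₂ ∸ e)

core-facts : ∀ {m n q X y₁ y₂ E N e} → n < m → Prime q → ¬ 2 ∣ q → .{{NonZero X}} →
             0 < y₂ → y₂ < y₁ → ¬ q ∣ X →
             X ^ m ∸ X ^ n ≡ q ^ y₁ ∸ q ^ y₂ → IsE q X E → m ∸ n ≡ E * N → IsVal q N e → ¬ 2 ∣ N →
             CoreFacts q X m n E N e y₁ y₂
core-facts {m} {n} {q} {X} {y₁} {y₂} {E} {N} {e}
           n<m q-prime q∤2 0<y₂ y₂<y₁ q∤X Xᵐ∸Xⁿ≡ isE m∸n≡EN isVal 2∤N = record
  { E≤m            = ≤-trans (m≤n+m E n) n+E≤m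
  ; identity       = identity
  ; bound          = size-bound {n = n} {E} n+E≤m (m^n>0 q y₂) (^-monoʳ-≤ q (<⇒≤ y₂<y₁)) Xᵐ∸Xⁿ≡
  ; e<y₂           = m∸n≢0⇒n<m (≢-sym (<⇒≢ (Valuation-∣⇒>0 q-prime q∣Xᴱ∸1 Valuation-Xᴱ∸1)))
  ; Valuation-I    = Valuation-I
  ; Valuation-Xᴱ∸1 = Valuation-Xᴱ∸1
  }
  where
  instance
    q≢0 : NonZero q
    q≢0 = prime⇒nonZero q-prime
  I = I-poly E N X
  D = q ^ (y₁ ∸ y₂) ∸ 1

  n+E≤m : n + E ≤ m
  n+E≤m with odd⇒suc[*2] 2∤N
  ... | j , refl = subst (n + E ≤_) (m+[n∸m]≡n (<⇒≤ n<m))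
                     (+-monoʳ-≤ n (subst (E ≤_) (sym m∸n≡EN) (m≤m*n E (suc (j * 2)))))

  identity : X ^ n * ((X ^ E ∸ 1) * I) ≡ q ^ y₂ * D
  identity = key-identity {E = E} {N} (<⇒≤ n<m) (<⇒≤ y₂<y₁) m∸n≡EN Xᵐ∸Xⁿ≡

  Valuation-[Xᴱ∸1]I : Valuation q ((X ^ E ∸ 1) * I) y₂
  Valuation-[Xᴱ∸1]I = Valuation-*-∤ q-prime y₂ (∤^ q-prime n q∤X)
    (subst (λ a → Valuation q a y₂) (trans (sym identity) (*-comm (X ^ n) _))
      (valuation D refl (∤^∸1 q-prime (y₁ ∸ y₂) (m<n⇒0<n∸m y₂<y₁))))

  q∣Xᴱ∸1 : q ∣ X ^ E ∸ 1
  q∣Xᴱ∸1 with PlusMinusOne⇒∣ X E (proj₁ (proj₂ isE))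
  ... | inj₁ q∣Xᴱ∸1 = q∣Xᴱ∸1
  ... | inj₂ q∣Xᴱ+1 = contradiction q∣Xᴱ+1 (∣^∸1⇒∤+1 q-prime q∤2 2∤N (X ^ E) q∣[Xᴱ]ᴺ∸1)
    where
    q∣[Xᴱ]ᴺ∸1 : q ∣ (X ^ E) ^ N ∸ 1
    q∣[Xᴱ]ᴺ∸1 = subst (q ∣_) (trans (sym (^∸1≡[^∸1]*I-poly X E N)) (cong (_∸ 1) (sym (^-*-assoc X E N))))
                  (∣-trans (m∣m^n q 0<y₂) (Valuation⇒∣ Valuation-[Xᴱ∸1]I))

  Valuation-I : Valuation q I e
  Valuation-I with q∣Xᴱ∸1
  ... | divides t Xᴱ∸1≡tq = subst (λ a → Valuation q a e) (sym I≡geom)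
                              (Valuation-geom q-prime q∤2 t e (IsVal⇒Valuation isVal))
    where
    Xᴱ≡1+qt : X ^ E ≡ 1 + q * t
    Xᴱ≡1+qt = trans (sym (m∸n+n≡m (m^n>0 X E))) (trans (cong (_+ 1) (trans Xᴱ∸1≡tq (*-comm t q))) (+-comm (q * t) 1))
    I≡geom : I ≡ geom (1 + q * t) N
    I≡geom = trans (geomSum≡geom E X N) (cong (λ Y → geom Y N) Xᴱ≡1+qt)

  Valuation-Xᴱ∸1 : Valuation q (X ^ E ∸ 1) (y₂ ∸ e)
  Valuation-Xᴱ∸1 = proj₂ (Valuation-cancelʳ q-prime e Valuation-[Xᴱ∸1]I Valuation-I)

-- Size estimates

E≡1-bound : ∀ {q x} s r y → 1 < q → q ^ s ≤ x → suc x ^ r * x < q ^ y → suc r * s < y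
E≡1-bound {q} {x} s r y 1<q qˢ≤x Xʳx<qʸ = subst (_< y) (*-comm s (suc r)) (^-cancelˡ-< q 1<q (begin-strict
  q ^ (s * suc r)   ≡⟨ sym (^-*-assoc q s (suc r)) ⟩
  (q ^ s) ^ suc r   ≤⟨ ^-monoˡ-≤ (suc r) qˢ≤x ⟩
  x * x ^ r         ≡⟨ *-comm x (x ^ r) ⟩
  x ^ r * x         ≤⟨ *-monoˡ-≤ x (^-monoˡ-≤ r (n≤1+n x)) ⟩
  suc x ^ r * x     <⟨ Xʳx<qʸ ⟩
  q ^ y             ∎))
  where open ≤-Reasoning

-- Split P^m = P^(r+1) P^f for P = xA, and use P < X^E on the first factor and X^r P < q^y on the second.
K>1-bound : ∀ {q x A} s r f y → .{{NonZero f}} → 1 < q → 0 < x → x * A + 1 ≡ suc x ^ suc f → 2 * q ^ s ≤ A →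
            suc x ^ r * (x * A) < q ^ y → (r + suc f) * s < y * f
K>1-bound {q} {x} {A} s r f y 1<q 0<x P+1≡Xᴱ 2qˢ≤A XʳP<qʸ =
  subst (_< y * f) (*-comm s m) (^-cancelˡ-< q 1<q (*-cancelˡ-< ((2 * x) ^ m) _ _ (begin-strict
    (2 * x) ^ m * q ^ (s * m)       ≡⟨ cong ((2 * x) ^ m *_) (sym (^-*-assoc q s m)) ⟩
    (2 * x) ^ m * (q ^ s) ^ m       ≡⟨ sym (^-distrib-* (2 * x) (q ^ s) m) ⟩
    (2 * x * q ^ s) ^ m             ≡⟨ cong (_^ m) (swap x (q ^ s)) ⟩
    (x * (2 * q ^ s)) ^ m           ≤⟨ ^-monoˡ-≤ m (*-monoʳ-≤ x 2qˢ≤A) ⟩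
    P ^ m                           ≡⟨ cong (P ^_) (+-suc r f) ⟩
    P ^ (suc r + f)                 ≡⟨ ^-distribˡ-+-* P (suc r) f ⟩
    P ^ suc r * P ^ f               ≤⟨ *-monoˡ-≤ (P ^ f) (^-monoˡ-≤ (suc r) P≤Xᴱ) ⟩
    (X ^ suc f) ^ suc r * P ^ f     ≡⟨ cong (_* P ^ f) Xᴱ⁽ʳ⁺¹⁾≡ ⟩
    X ^ m * (X ^ r) ^ f * P ^ f     ≡⟨ *-assoc (X ^ m) _ _ ⟩
    X ^ m * ((X ^ r) ^ f * P ^ f)   ≡⟨ cong (X ^ m *_) (sym (^-distrib-* (X ^ r) P f)) ⟩
    X ^ m * (X ^ r * P) ^ f         ≤⟨ *-monoˡ-≤ _ (^-monoˡ-≤ m (suc≤2* 0<x)) ⟩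
    (2 * x) ^ m * (X ^ r * P) ^ f   <⟨ *-monoʳ-< ((2 * x) ^ m) (^-monoˡ-< f XʳP<qʸ) ⟩
    (2 * x) ^ m * (q ^ y) ^ f       ≡⟨ cong ((2 * x) ^ m *_) (^-*-assoc q y f) ⟩
    (2 * x) ^ m * q ^ (y * f)       ∎)))
  where
  open ≤-Reasoning
  X = suc x
  P = x * A
  m = r + suc f
  instance
    [2x]ᵐ≢0 : NonZero ((2 * x) ^ m)
    [2x]ᵐ≢0 = m^n≢0 (2 * x) m {{>-nonZero (*-monoʳ-< 2 0<x)}}
  swap : ∀ x w → 2 * x * w ≡ x * (2 * w)
  swap = solve-∀
  P≤Xᴱ : P ≤ X ^ suc f
  P≤Xᴱ = subst (P ≤_) P+1≡Xᴱ (m≤m+n P 1)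
  Xᴱ⁽ʳ⁺¹⁾≡ : (X ^ suc f) ^ suc r ≡ X ^ m * (X ^ r) ^ f
  Xᴱ⁽ʳ⁺¹⁾≡ = begin-equality
    (X ^ suc f) ^ suc r      ≡⟨ ^-*-assoc X (suc f) (suc r) ⟩
    X ^ (suc f * suc r)      ≡⟨ cong (X ^_) (expand f r) ⟩
    X ^ (m + r * f)          ≡⟨ ^-distribˡ-+-* X m (r * f) ⟩
    X ^ m * X ^ (r * f)      ≡⟨ cong (X ^ m *_) (sym (^-*-assoc X r f)) ⟩
    X ^ m * (X ^ r) ^ f      ∎
    where
    expand : ∀ f r → suc f * suc r ≡ (r + suc f) + r * f
    expand = solve-∀

-- The key point is A < 2 X^f, from x A < X^E = X · X^f ≤ 2x · X^f.
LogCond-bound : ∀ {q x A} s r f y a δ → .{{NonZero f}} → 1 < q → 0 < x → x * A + 1 ≡ suc x ^ suc f → q ^ s ≤ A →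
                suc x ^ (r + suc f) < 2 ^ δ * q ^ y → 2 ^ ((r + suc f) + δ * f) ≤ q ^ a → s * (r + suc f) < a + y * f
LogCond-bound {q} {x} {A} s r f y a δ 1<q 0<x xA+1≡Xᴱ qˢ≤A Xᵐ<2^δqʸ 2^[m+δf]≤qᵃ =
  ^-cancelˡ-< q 1<q (begin-strict
    q ^ (s * m)                         ≡⟨ sym (^-*-assoc q s m) ⟩
    (q ^ s) ^ m                         ≤⟨ ^-monoˡ-≤ m (≤-trans qˢ≤A (<⇒≤ A<2Xᶠ)) ⟩
    (2 * X ^ f) ^ m                     ≡⟨ ^-distrib-* 2 (X ^ f) m ⟩
    2 ^ m * (X ^ f) ^ m                 ≡⟨ cong (2 ^ m *_) (^-swap X f m) ⟩
    2 ^ m * (X ^ m) ^ f                 <⟨ *-monoʳ-< (2 ^ m) (^-monoˡ-< f Xᵐ<2^δqʸ) ⟩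
    2 ^ m * (2 ^ δ * q ^ y) ^ f         ≡⟨ cong (2 ^ m *_) (^-distrib-* (2 ^ δ) (q ^ y) f) ⟩
    2 ^ m * ((2 ^ δ) ^ f * (q ^ y) ^ f) ≡⟨ cong₂ (λ u v → 2 ^ m * (u * v)) (^-*-assoc 2 δ f) (^-*-assoc q y f) ⟩
    2 ^ m * (2 ^ (δ * f) * q ^ (y * f)) ≡⟨ sym (*-assoc (2 ^ m) _ _) ⟩
    2 ^ m * 2 ^ (δ * f) * q ^ (y * f)   ≡⟨ cong (_* q ^ (y * f)) (sym (^-distribˡ-+-* 2 m (δ * f))) ⟩
    2 ^ (m + δ * f) * q ^ (y * f)       ≤⟨ *-monoˡ-≤ _ 2^[m+δf]≤qᵃ ⟩
    q ^ a * q ^ (y * f)                 ≡⟨ sym (^-distribˡ-+-* q a (y * f)) ⟩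
    q ^ (a + y * f)                     ∎)
  where
  open ≤-Reasoning
  X = suc x
  m = r + suc f
  instance
    x≢0 : NonZero x
    x≢0 = >-nonZero 0<x
    2ᵐ≢0 : NonZero (2 ^ m)
    2ᵐ≢0 = m^n≢0 2 m
  ^-swap : ∀ X f m → (X ^ f) ^ m ≡ (X ^ m) ^ f
  ^-swap X f m = trans (^-*-assoc X f m) (trans (cong (X ^_) (*-comm f m)) (sym (^-*-assoc X m f)))
  A<2Xᶠ : A < 2 * X ^ f
  A<2Xᶠ = *-cancelˡ-< x A (2 * X ^ f) (begin-strict
    x * A               <⟨ m<m+n (x * A) z<s ⟩
    x * A + 1           ≡⟨ xA+1≡Xᴱ ⟩
    X * X ^ f           ≤⟨ *-monoˡ-≤ (X ^ f) (suc≤2* 0<x) ⟩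
    2 * x * X ^ f       ≡⟨ swap x (X ^ f) ⟩
    x * (2 * X ^ f)     ∎)
    where
    swap : ∀ x w → 2 * x * w ≡ x * (2 * w)
    swap = solve-∀

^<2* : ∀ {x A Q} r f → 0 < x * A → x * A + 1 ≡ suc x ^ suc f → suc x ^ r * (x * A) < Q → suc x ^ (r + suc f) < 2 * Q
^<2* {x} {A} {Q} r f 0<P P+1≡Xᴱ XʳP<Q = begin-strict
  X ^ (r + suc f)       ≡⟨ ^-distribˡ-+-* X r (suc f) ⟩
  X ^ r * X ^ suc f     ≡⟨ cong (X ^ r *_) (sym P+1≡Xᴱ) ⟩
  X ^ r * (P + 1)       ≤⟨ *-monoʳ-≤ (X ^ r) (+-monoʳ-≤ P 0<P) ⟩
  X ^ r * (P + P)       ≡⟨ double (X ^ r) P ⟩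
  2 * (X ^ r * P)       <⟨ *-monoʳ-< 2 XʳP<Q ⟩
  2 * Q                 ∎
  where
  open ≤-Reasoning
  X = suc x
  P = x * A
  double : ∀ w p → w * (p + p) ≡ 2 * (w * p)
  double = solve-∀

-- With E = 1 + f the numerator of LogCond is s (m − 2f) + f; adding 2sf brings it into ℕ.
LogCond-numerator : ∀ s m f a →
  (ℤ.+ s) ℤ.* ((ℤ.+ m) ℤ.- (ℤ.+ (2 * suc f)) ℤ.+ (ℤ.+ 2)) ℤ.+ (ℤ.+ suc f) ℤ.- ℤ.1ℤ ≡ ℤ.+ a →
  a + 2 * s * f ≡ s * m + f
LogCond-numerator s m f a numerator≡a = ℤ.+-injective (begin
  ℤ.+ (a + 2 * s * f)                         ≡⟨ cong₂ ℤ._+_ (sym numerator≡a) (ℤ.pos-* (2 * s) f) ⟩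
  shape (ℤ.+ (2 * suc f)) (ℤ.+ (2 * s))       ≡⟨ cong₂ shape (ℤ.pos-* 2 (suc f)) (ℤ.pos-* 2 s) ⟩
  shape (ℤ.+ 2 ℤ.* (ℤ.1ℤ ℤ.+ F)) (ℤ.+ 2 ℤ.* S) ≡⟨ simplify S M F ⟩
  S ℤ.* M ℤ.+ F                               ≡⟨ cong (ℤ._+ F) (sym (ℤ.pos-* s m)) ⟩
  ℤ.+ (s * m + f)                             ∎)
  where
  open ≡-Reasoning
  S = ℤ.+ s
  M = ℤ.+ m
  F = ℤ.+ f
  shape : ℤ.ℤ → ℤ.ℤ → ℤ.ℤ
  shape 2E 2S = S ℤ.* (M ℤ.- 2E ℤ.+ ℤ.+ 2) ℤ.+ (ℤ.1ℤ ℤ.+ F) ℤ.- ℤ.1ℤ ℤ.+ 2S ℤ.* F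
  simplify : ∀ S M F → S ℤ.* (M ℤ.- ℤ.+ 2 ℤ.* (ℤ.1ℤ ℤ.+ F) ℤ.+ ℤ.+ 2) ℤ.+ (ℤ.1ℤ ℤ.+ F) ℤ.- ℤ.1ℤ
                       ℤ.+ ℤ.+ 2 ℤ.* S ℤ.* F
                     ≡ S ℤ.* M ℤ.+ F
  simplify = ℤ-Solver.solve-∀

LogCond⇒2s≤y : ∀ {a y} s m f → .{{NonZero f}} → a + 2 * s * f ≡ s * m + f → s * m < a + y * f → 2 * s ≤ y
LogCond⇒2s≤y {a} {y} s m f a+2sf≡sm+f sm<a+yf = s≤s⁻¹ (*-cancelʳ-< f (2 * s) (suc y) (+-cancelˡ-< a _ _ (begin-strict
  a + 2 * s * f         ≡⟨ a+2sf≡sm+f ⟩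
  s * m + f             <⟨ +-monoˡ-< f sm<a+yf ⟩
  a + y * f + f         ≡⟨ +-assoc a (y * f) f ⟩
  a + (y * f + f)       ≡⟨ cong (a +_) (+-comm (y * f) f) ⟩
  a + suc y * f         ∎)))
  where open ≤-Reasoning

-- The cofactor K

CofactorStatement : (m n q X y₁ y₂ E N e : ℕ) → Set
CofactorStatement m n q X y₁ y₂ E N e =
  Σ ℕ (λ K →
    (0 < K) × Coprime K q
    × (A-poly E X ≡ K * q ^ (y₂ ∸ e))
    × (B-poly n E X * I-poly E N X * K ≡ q ^ e * (q ^ (y₁ ∸ y₂) ∸ 1))
    × (E ≡ 1 →
        (y₁ > 2 * (y₂ ∸ e)) × (1 < K → y₁ > m * (y₂ ∸ e)))
    × (1 < E →
        (1 < K → m * (y₂ ∸ e) ≤ y₁ * (E ∸ 1))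
        × (q ^ y₁ < X ^ m → LogCond q m E y₂ e 1 → y₁ ≥ 2 * (y₂ ∸ e))
        × (X ^ m < q ^ y₁ → LogCond q m E y₂ e 0 → y₁ ≥ 2 * (y₂ ∸ e))))

cancel-q^ : ∀ q e s {B K I D} → .{{NonZero q}} → B * (K * q ^ s) * I ≡ q ^ (e + s) * D → B * I * K ≡ q ^ e * D
cancel-q^ q e s {B} {K} {I} {D} eq = *-cancelˡ-≡ _ _ (q ^ s) {{m^n≢0 q s}} (begin
  q ^ s * (B * I * K)     ≡⟨ regroup (q ^ s) B I K ⟩
  B * (K * q ^ s) * I     ≡⟨ eq ⟩
  q ^ (e + s) * D         ≡⟨ cong (_* D) (^-distribˡ-+-* q e s) ⟩
  q ^ e * q ^ s * D       ≡⟨ regroup′ (q ^ e) (q ^ s) D ⟩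
  q ^ s * (q ^ e * D)     ∎)
  where
  open ≡-Reasoning
  regroup : ∀ w b i k → w * (b * i * k) ≡ b * (k * w) * i
  regroup = solve-∀
  regroup′ : ∀ a w d → a * w * d ≡ w * (a * d)
  regroup′ = solve-∀

cofactor : ∀ {m n q X y₁ y₂ E N e B A} → Prime q → CoreFacts q X m n E N e y₁ y₂ →
           0 < A → B * A ≡ X ^ n * (X ^ E ∸ 1) → Valuation q A (y₂ ∸ e) →
           Σ ℕ λ K → (0 < K) × Coprime K q × (A ≡ K * q ^ (y₂ ∸ e))
                     × (B * I-poly E N X * K ≡ q ^ e * (q ^ (y₁ ∸ y₂) ∸ 1))
cofactor {n = n} {q} {X} {y₁} {y₂} {E} {N} {e} {B} {A} q-prime R 0<A BA≡ (valuation K A≡qˢK q∤K) =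
  K , 0<K , ∤⇒coprime q-prime q∤K , A≡Kqˢ ,
  cancel-q^ q e s {B} {K} {I} {{prime⇒nonZero q-prime}} (begin
    B * (K * q ^ s) * I         ≡⟨ cong (λ a → B * a * I) (sym A≡Kqˢ) ⟩
    B * A * I                   ≡⟨ cong (_* I) BA≡ ⟩
    X ^ n * (X ^ E ∸ 1) * I     ≡⟨ *-assoc (X ^ n) _ I ⟩
    X ^ n * ((X ^ E ∸ 1) * I)   ≡⟨ CoreFacts.identity R ⟩
    q ^ y₂ * D                  ≡⟨ cong (λ v → q ^ v * D) (sym (m+[n∸m]≡n (<⇒≤ (CoreFacts.e<y₂ R)))) ⟩
    q ^ (e + s) * D             ∎)
  where
  open ≡-Reasoning
  s = y₂ ∸ e
  I = I-poly E N X
  D = q ^ (y₁ ∸ y₂) ∸ 1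
  A≡Kqˢ = trans A≡qˢK (*-comm (q ^ s) K)
  0<K : 0 < K
  0<K = >-nonZero⁻¹ K {{m*n≢0⇒n≢0 (q ^ s) {{subst NonZero A≡qˢK (>-nonZero 0<A)}}}}

-- For E = 1 the bound y₁ > m(y₂ − e) holds without the hypothesis K > 1.
E≡1-case : ∀ {r n q x y₁ y₂ N e} → Prime q → 2 ≤ r → 0 < x → CoreFacts q (suc x) (suc r) n 1 N e y₁ y₂ →
           CofactorStatement (suc r) n q (suc x) y₁ y₂ 1 N e
E≡1-case {r} {n} {q} {x} {y₁} {y₂} {N} {e} q-prime 2≤r 0<x R =
  let K , 0<K , K⊥q , x≡Kqˢ , BIK≡ = cofactor {B = X ^ n} q-prime R 0<x Xⁿx≡ Valuation-x
  in  K , 0<K , K⊥q , x≡Kqˢ , BIK≡ , (λ _ → 2s<y₁ , λ _ → [r+1]s<y₁) , λ { (s≤s ()) }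
  where
  X = suc x
  s = y₂ ∸ e
  Xⁿx≡ : X ^ n * x ≡ X ^ n * (X ^ 1 ∸ 1)
  Xⁿx≡ = cong (X ^ n *_) (sym (*-identityʳ x))
  Valuation-x : Valuation q x s
  Valuation-x = subst (λ a → Valuation q a s) (*-identityʳ x) (CoreFacts.Valuation-Xᴱ∸1 R)
  [r+1]s<y₁ : suc r * s < y₁
  [r+1]s<y₁ = E≡1-bound s r y₁ (prime⇒1< q-prime) (∣⇒≤ {{>-nonZero 0<x}} (Valuation⇒∣ Valuation-x))
                (subst (λ a → X ^ r * a < q ^ y₁) (*-identityʳ x) (CoreFacts.bound R))
  2s<y₁ : 2 * s < y₁
  2s<y₁ = ≤-<-trans (*-monoˡ-≤ s (m≤n⇒m≤1+n 2≤r)) [r+1]s<y₁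

E>1-case : ∀ {m n q x y₁ y₂ N e} k → Prime q → 0 < x → IsE q (suc x) (2 + k) →
           CoreFacts q (suc x) m n (2 + k) N e y₁ y₂ →
           CofactorStatement m n q (suc x) y₁ y₂ (2 + k) N e
E>1-case {m} {n} {q} {x} {y₁} {y₂} {N} {e} k q-prime 0<x isE R =
  let K , 0<K , K⊥q , A≡Kqˢ , BIK≡ = cofactor {B = X ^ n * x} q-prime R 0<A XⁿxA≡ Valuation-A
  in  K , 0<K , K⊥q , A≡Kqˢ , BIK≡ , (λ ()) ,
      λ _ → K>1⇒ A≡Kqˢ , (λ _ → LogCond⇒ 1 Xᵐ<2qʸ¹)
          , (λ Xᵐ<qʸ¹ → LogCond⇒ 0 (subst (X ^ m <_) (sym (+-identityʳ _)) Xᵐ<qʸ¹))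
  where
  X = suc x
  E = 2 + k
  f = suc k
  s = y₂ ∸ e
  A = geom X E
  1<q = prime⇒1< q-prime
  m≡r+E : m ≡ (m ∸ E) + E
  m≡r+E = sym (m∸n+n≡m (CoreFacts.E≤m R))
  xA+1≡Xᴱ : x * A + 1 ≡ X ^ E
  xA+1≡Xᴱ = geom-telescope x E
  Xᴱ∸1≡xA : X ^ E ∸ 1 ≡ x * A
  Xᴱ∸1≡xA = trans (cong (_∸ 1) (sym xA+1≡Xᴱ)) (m+n∸n≡m (x * A) 1)
  XⁿxA≡ : X ^ n * x * A ≡ X ^ n * (X ^ E ∸ 1)
  XⁿxA≡ = trans (*-assoc (X ^ n) x A) (cong (X ^ n *_) (sym Xᴱ∸1≡xA))
  0<A : 0 < A
  0<A = ≤-trans (m^n>0 X f) (^≤geom X f)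
  -- X ≡ 1 (mod q) would contradict the minimality of E = e_q(X) ≥ 2.
  q∤x : ¬ q ∣ x
  q∤x q∣x with proj₂ (proj₂ isE) 1 z<s (inj₁ (∣m⇒∣m*n 1 q∣x))
  ... | s≤s ()
  Valuation-A : Valuation q A s
  Valuation-A = Valuation-*-∤ q-prime s q∤x
    (subst (λ a → Valuation q a s) (trans Xᴱ∸1≡xA (*-comm x A)) (CoreFacts.Valuation-Xᴱ∸1 R))
  XʳxA<qʸ¹ : X ^ (m ∸ E) * (x * A) < q ^ y₁
  XʳxA<qʸ¹ = subst (λ a → X ^ (m ∸ E) * a < q ^ y₁) Xᴱ∸1≡xA (CoreFacts.bound R)
  Xᵐ<2qʸ¹ : X ^ m < 2 * q ^ y₁
  Xᵐ<2qʸ¹ = subst (λ i → X ^ i < 2 * q ^ y₁) (sym m≡r+E) (^<2* (m ∸ E) f 0<xA xA+1≡Xᴱ XʳxA<qʸ¹)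
    where
    0<xA : 0 < x * A
    0<xA = >-nonZero⁻¹ (x * A) {{m*n≢0 x A {{>-nonZero 0<x}} {{>-nonZero 0<A}}}}
  K>1⇒ : ∀ {K} → A ≡ K * q ^ s → 1 < K → m * s ≤ y₁ * f
  K>1⇒ {K} A≡Kqˢ 1<K = <⇒≤ (subst (λ i → i * s < y₁ * f) (sym m≡r+E)
    (K>1-bound s (m ∸ E) f y₁ 1<q 0<x xA+1≡Xᴱ (subst (2 * q ^ s ≤_) (sym A≡Kqˢ) (*-monoˡ-≤ (q ^ s) 1<K)) XʳxA<qʸ¹))
  LogCond⇒ : ∀ δ → X ^ m < 2 ^ δ * q ^ y₁ → LogCond q m E y₂ e δ → 2 * s ≤ y₁
  LogCond⇒ δ Xᵐ< (a , numerator≡a , 2^≤qᵃ) =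
    LogCond⇒2s≤y s m f (LogCond-numerator s m f a numerator≡a)
      (subst (λ i → s * i < a + y₁ * f) (sym m≡r+E)
        (LogCond-bound s (m ∸ E) f y₁ a δ 1<q 0<x xA+1≡Xᴱ (∣⇒≤ {{>-nonZero 0<A}} (Valuation⇒∣ Valuation-A))
          (subst (λ i → X ^ i < 2 ^ δ * q ^ y₁) m≡r+E Xᵐ<)
          (subst (λ i → 2 ^ (i + δ * f) ≤ q ^ a) m≡r+E 2^≤qᵃ)))

cofactor-statement : ∀ {m n q x y₁ y₂ N e} E → Prime q → 3 ≤ m → 0 < x → IsE q (suc x) E →
                     CoreFacts q (suc x) m n E N e y₁ y₂ → CofactorStatement m n q (suc x) y₁ y₂ E N e
cofactor-statement zero          _       _         _   (() , _) _
cofactor-statement (suc zero)    q-prime (s≤s 2≤r) 0<x _        R = E≡1-case q-prime 2≤r 0<x R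
cofactor-statement (suc (suc k)) q-prime _         0<x isE      R = E>1-case k q-prime 0<x isE R

lemma11p3 : (m n q X y₁ y₂ E N e : ℕ) →
  0 < n → n < m → 3 ≤ m →
  Prime q → ¬ (2 ∣ q) →
  1 < X → 0 < y₂ → y₂ < y₁ → Coprime X q →
  X ^ m ∸ X ^ n ≡ q ^ y₁ ∸ q ^ y₂ →
  IsE q X E →
  m ∸ n ≡ E * N →
  IsVal q N e →
  ¬ (2 ∣ N) →
  (e < y₂)
  × (q ^ e ∣ I-poly E N X)
  × Σ ℕ (λ K →
      (0 < K) × Coprime K q
      × (A-poly E X ≡ K * q ^ (y₂ ∸ e))
      × (B-poly n E X * I-poly E N X * K ≡ q ^ e * (q ^ (y₁ ∸ y₂) ∸ 1))
      × (E ≡ 1 →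
          (y₁ > 2 * (y₂ ∸ e)) × (1 < K → y₁ > m * (y₂ ∸ e)))
      × (1 < E →
          (1 < K → m * (y₂ ∸ e) ≤ y₁ * (E ∸ 1))
          × (q ^ y₁ < X ^ m → LogCond q m E y₂ e 1 → y₁ ≥ 2 * (y₂ ∸ e))
          × (X ^ m < q ^ y₁ → LogCond q m E y₂ e 0 → y₁ ≥ 2 * (y₂ ∸ e))))
lemma11p3 m n q (suc x) y₁ y₂ E N e _ n<m 3≤m q-prime q∤2 (s≤s 0<x) 0<y₂ y₂<y₁ X⊥q
          Xᵐ∸Xⁿ≡ isE m∸n≡EN isVal 2∤N =
  CoreFacts.e<y₂ R , Valuation⇒∣ (CoreFacts.Valuation-I R) , cofactor-statement E q-prime 3≤m 0<x isE R
  where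
  R : CoreFacts q (suc x) m n E N e y₁ y₂
  R = core-facts n<m q-prime q∤2 0<y₂ y₂<y₁ (coprime⇒∤ q-prime X⊥q) Xᵐ∸Xⁿ≡ isE m∸n≡EN isVal 2∤N
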